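{- Let $G=(V,E)$ be a finite graph and $e\in E$. Then $$\gamma_{coe}(G)-2\leq \gamma_{coe}(G/e)\leq \gamma_{coe}(G).$$
   Context: All graphs are finite, without loops and without directed edges. For a graph $H=(V,E)$, a set $D\subseteq V$ is a dominating set if every vertex in $V\setminus D$ is adjacent to at least one vertex of $D$. A dominating set $D$ is a co-even dominating set if every vertex $u\in V\setminus D$ has even degree in $H$ (the number of edges incident to $u$). The co-even domination number $\gamma_{coe}(H)$ is the minimum cardinality of a co-even dominating set of $H$. For an edge $e$ with endpoints $u,v$, the edge contraction $G/e$ is obtained by replacing $u$ and $v$ with a single new vertex $w$, whose incident edges are exactly the edges other than $e$ that were incident with $u$ or $v$; thus $G/e$ has exactly one edge fewer than $G$. -}

module Defs where

open import Data.Nat using (ℕ; zero; suc; _+_; _≤_)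
open import Data.Nat.Divisibility using (_∣_)
open import Data.Fin using (Fin; _≟_; punchOut)
open import Data.Fin.Subset using (Subset; _∈_; _∉_; ∣_∣)
open import Data.List using (List; []; _∷_; length; lookup; removeAt; map)
open import Data.List.Membership.Propositional using () renaming (_∈_ to _∈ˡ_)
open import Data.Product using (_×_; _,_; proj₁; proj₂; Σ; ∃; ∃-syntax)
open import Data.Sum using (_⊎_)
open import Relation.Nullary using (¬_; yes; no)
open import Relation.Binary.PropositionalEquality using (_≡_; _≢_)

-- A finite (multi)graph on the vertex set Fin n: a list of edges, each an
-- unordered pair of endpoints stored as an ordered pair.  Parallel edges are
-- allowed (edge contraction can create them).
Graph : ℕ → Set
Graph n = List (Fin n × Fin n)

Loopless : ∀ {n} → Graph n → Set
Loopless G = ∀ (e : Fin (length G)) → proj₁ (lookup G e) ≢ proj₂ (lookup G e)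

[_≟_]ᵇ : ∀ {n} → Fin n → Fin n → ℕ
[ x ≟ y ]ᵇ with x ≟ y
... | yes _ = 1
... | no _  = 0

degree : ∀ {n} → Graph n → Fin n → ℕ
degree [] u = 0
degree ((a , b) ∷ G) u = [ a ≟ u ]ᵇ + [ b ≟ u ]ᵇ + degree G u

Adjacent : ∀ {n} → Graph n → Fin n → Fin n → Set
Adjacent G u d = ((u , d) ∈ˡ G) ⊎ ((d , u) ∈ˡ G)

IsDominating : ∀ {n} → Graph n → Subset n → Set
IsDominating G D = ∀ u → u ∉ D → ∃[ d ] (d ∈ D × Adjacent G u d)

IsCoEvenDominating : ∀ {n} → Graph n → Subset n → Set
IsCoEvenDominating G D = IsDominating G D × (∀ u → u ∉ D → 2 ∣ degree G u)

γcoe : ∀ {n} → Graph n → ℕ → Set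
γcoe G k =
  (∃[ D ] (IsCoEvenDominating G D × ∣ D ∣ ≡ k)) ×
  (∀ D → IsCoEvenDominating G D → k ≤ ∣ D ∣)

-- merging v into u: Fin (suc m) → Fin m, v and u both go to the new vertex
mergeMap : ∀ {m} {u v : Fin (suc m)} → v ≢ u → Fin (suc m) → Fin m
mergeMap {u = u} {v} v≢u x with x ≟ v
... | yes _ = punchOut v≢u
... | no x≢v = punchOut {i = v} {j = x} (λ v≡x → x≢v (Relation.Binary.PropositionalEquality.sym v≡x))

contract : ∀ {m} (G : Graph (suc m)) (e : Fin (length G)) →
           proj₂ (lookup G e) ≢ proj₁ (lookup G e) → Graph m
contract G e v≢u = map (λ { (a , b) → (f a , f b) }) (removeAt G e)
  where f = mergeMap v≢u

-- Contracting e = uv maps vertices by the map f merging u and v into one vertex w.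
-- The image f(D) of a co-even dominating set D of G is co-even dominating in G/e:
-- vertices other than w keep their degree and their neighbours, and if w ∉ f(D)
-- then u, v ∉ D, so deg w = deg u + deg v − 2 is even and w inherits a dominator
-- of u (which is not v).  Conversely, for a co-even dominating set D' of G/e the
-- preimage f⁻¹(D' ∪ {w}) = f⁻¹(D') ∪ {u, v} is co-even dominating in G, and it has
-- at most |D'| + 2 elements since w is the only point of G/e with two preimages.
module Submission where

open import Defs
open import Function using (_∘_)
open import Data.Nat using (ℕ; suc; _+_; _≤_; z≤n; s≤s)
open import Data.Nat.Properties using (≤-reflexive; ≤-trans; m≤n⇒m≤1+n; +-suc; +-comm; module ≤-Reasoning)
open import Data.Nat.Divisibility using (_∣_; ∣m+n∣m⇒∣n; ∣m∣n⇒∣m+n; ∣-refl)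
open import Data.Nat.Tactic.RingSolver using (solve-∀)
open import Data.Fin using (Fin; zero; suc; _≟_; punchIn; punchOut)
open import Data.Fin.Properties using (punchOut-cong; punchOut-injective; punchIn-punchOut; punchOut-punchIn; punchInᵢ≢i)
open import Data.Fin.Subset using (Subset; inside; outside; _∈_; _∉_; _⊆_; _∪_; ⁅_⁆; ⊥; ∣_∣)
open import Data.Fin.Subset.Properties using (x∈p∪q⁺; x∈⁅x⁆; ∣⁅x⁆∣≡1; ∣⊥∣≡0; p⊆q⇒∣p∣≤∣q∣)
open import Data.Vec using (_∷_; []; here; there; tabulate) renaming (lookup to lookupᵛ)
open import Data.Vec.Properties using (lookup∘tabulate; []=⇒lookup; lookup⇒[]=)
open import Data.List using (List; _∷_; []; length; lookup; removeAt; map)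
open import Data.List.Relation.Unary.Any using (here; there)
open import Data.List.Membership.Propositional using () renaming (_∈_ to _∈ˡ_)
open import Data.List.Membership.Propositional.Properties using (∈-map⁺; ∈-map⁻)
open import Data.Product using (_×_; _,_; proj₁; proj₂; ∃-syntax)
open import Data.Sum using (_⊎_; inj₁; inj₂)
open import Relation.Nullary using (yes; no; contradiction)
open import Relation.Binary.PropositionalEquality using (_≡_; _≢_; refl; sym; trans; cong; cong₂; subst; module ≡-Reasoning)

∣p∪q∣≤∣p∣+∣q∣ : ∀ {n} (p q : Subset n) → ∣ p ∪ q ∣ ≤ ∣ p ∣ + ∣ q ∣
∣p∪q∣≤∣p∣+∣q∣ []            []            = z≤n
∣p∪q∣≤∣p∣+∣q∣ (outside ∷ p) (outside ∷ q) = ∣p∪q∣≤∣p∣+∣q∣ p q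
∣p∪q∣≤∣p∣+∣q∣ (outside ∷ p) (inside ∷ q)  =
  subst (suc ∣ p ∪ q ∣ ≤_) (sym (+-suc ∣ p ∣ ∣ q ∣)) (s≤s (∣p∪q∣≤∣p∣+∣q∣ p q))
∣p∪q∣≤∣p∣+∣q∣ (inside ∷ p)  (outside ∷ q) = s≤s (∣p∪q∣≤∣p∣+∣q∣ p q)
∣p∪q∣≤∣p∣+∣q∣ (inside ∷ p)  (inside ∷ q)  =
  s≤s (subst (∣ p ∪ q ∣ ≤_) (sym (+-suc ∣ p ∣ ∣ q ∣)) (m≤n⇒m≤1+n (∣p∪q∣≤∣p∣+∣q∣ p q)))

image : ∀ {n m} → (Fin n → Fin m) → Subset n → Subset m
image f []            = ⊥
image f (outside ∷ p) = image (f ∘ suc) p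
image f (inside ∷ p)  = ⁅ f zero ⁆ ∪ image (f ∘ suc) p

∈-image⁺ : ∀ {n m} (f : Fin n → Fin m) {p x} → x ∈ p → f x ∈ image f p
∈-image⁺ f               here        = x∈p∪q⁺ (inj₁ (x∈⁅x⁆ (f zero)))
∈-image⁺ f {outside ∷ p} (there x∈p) = ∈-image⁺ (f ∘ suc) x∈p
∈-image⁺ f {inside ∷ p}  (there x∈p) = x∈p∪q⁺ (inj₂ (∈-image⁺ (f ∘ suc) x∈p))

∣image∣≤∣p∣ : ∀ {n m} (f : Fin n → Fin m) p → ∣ image f p ∣ ≤ ∣ p ∣
∣image∣≤∣p∣ {m = m} f []   = ≤-reflexive (∣⊥∣≡0 m)
∣image∣≤∣p∣ f (outside ∷ p) = ∣image∣≤∣p∣ (f ∘ suc) p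
∣image∣≤∣p∣ f (inside ∷ p)  = begin
  ∣ ⁅ f zero ⁆ ∪ image (f ∘ suc) p ∣       ≤⟨ ∣p∪q∣≤∣p∣+∣q∣ ⁅ f zero ⁆ (image (f ∘ suc) p) ⟩
  ∣ ⁅ f zero ⁆ ∣ + ∣ image (f ∘ suc) p ∣   ≡⟨ cong (_+ ∣ image (f ∘ suc) p ∣) (∣⁅x⁆∣≡1 (f zero)) ⟩
  suc ∣ image (f ∘ suc) p ∣                ≤⟨ s≤s (∣image∣≤∣p∣ (f ∘ suc) p) ⟩
  suc ∣ p ∣                                ∎
  where open ≤-Reasoning

preimage : ∀ {n m} → (Fin n → Fin m) → Subset m → Subset n
preimage f q = tabulate (lookupᵛ q ∘ f)

∈-preimage⁺ : ∀ {n m} (f : Fin n → Fin m) {q x} → f x ∈ q → x ∈ preimage f q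
∈-preimage⁺ f {q} {x} fx∈q =
  lookup⇒[]= x (preimage f q) (trans (lookup∘tabulate (lookupᵛ q ∘ f) x) ([]=⇒lookup fx∈q))

∈-preimage⁻ : ∀ {n m} (f : Fin n → Fin m) {q x} → x ∈ preimage f q → f x ∈ q
∈-preimage⁻ f {q} {x} x∈ =
  lookup⇒[]= (f x) q (trans (sym (lookup∘tabulate (lookupᵛ q ∘ f) x)) ([]=⇒lookup x∈))

preimage⊆⁅i⁆∪image-punchIn : ∀ {n} (f : Fin (suc n) → Fin n) i → (∀ j → f (punchIn i j) ≡ j) →
                             ∀ q → preimage f q ⊆ ⁅ i ⁆ ∪ image (punchIn i) q
preimage⊆⁅i⁆∪image-punchIn f i section q {x} x∈ with i ≟ x
... | yes refl = x∈p∪q⁺ (inj₁ (x∈⁅x⁆ i))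
... | no i≢x   = x∈p∪q⁺ (inj₂ (subst (_∈ image (punchIn i) q) (punchIn-punchOut i≢x) (∈-image⁺ (punchIn i) j∈q)))
  where
  j∈q : punchOut i≢x ∈ q
  j∈q = subst (_∈ q) (trans (cong f (sym (punchIn-punchOut i≢x))) (section (punchOut i≢x))) (∈-preimage⁻ f x∈)

∣preimage∣≤1+∣q∣ : ∀ {n} (f : Fin (suc n) → Fin n) i → (∀ j → f (punchIn i j) ≡ j) →
                   ∀ q → ∣ preimage f q ∣ ≤ suc ∣ q ∣
∣preimage∣≤1+∣q∣ f i section q = begin
  ∣ preimage f q ∣                         ≤⟨ p⊆q⇒∣p∣≤∣q∣ (preimage⊆⁅i⁆∪image-punchIn f i section q) ⟩
  ∣ ⁅ i ⁆ ∪ image (punchIn i) q ∣          ≤⟨ ∣p∪q∣≤∣p∣+∣q∣ ⁅ i ⁆ (image (punchIn i) q) ⟩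
  ∣ ⁅ i ⁆ ∣ + ∣ image (punchIn i) q ∣      ≡⟨ cong (_+ ∣ image (punchIn i) q ∣) (∣⁅x⁆∣≡1 i) ⟩
  suc ∣ image (punchIn i) q ∣              ≤⟨ s≤s (∣image∣≤∣p∣ (punchIn i) q) ⟩
  suc ∣ q ∣                                ∎
  where open ≤-Reasoning

module _ {m} {u v : Fin (suc m)} (v≢u : v ≢ u) where

  mergeMap-v : mergeMap v≢u v ≡ punchOut v≢u
  mergeMap-v with v ≟ v
  ... | yes _   = refl
  ... | no v≢v = contradiction refl v≢v

  mergeMap-≢ : ∀ {x} (v≢x : v ≢ x) → mergeMap v≢u x ≡ punchOut v≢x
  mergeMap-≢ {x} v≢x with x ≟ v
  ... | yes x≡v = contradiction (sym x≡v) v≢x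
  ... | no _    = punchOut-cong v refl

  mergeMap-u : mergeMap v≢u u ≡ punchOut v≢u
  mergeMap-u = mergeMap-≢ v≢u

  mergeMap-punchIn : ∀ y → mergeMap v≢u (punchIn v y) ≡ y
  mergeMap-punchIn y = trans (mergeMap-≢ (punchInᵢ≢i v y ∘ sym)) (punchOut-punchIn v)

  mergeMap-fibre-merged : ∀ {x} → mergeMap v≢u x ≡ punchOut v≢u → x ≡ u ⊎ x ≡ v
  mergeMap-fibre-merged {x} fx≡w with v ≟ x
  ... | yes v≡x = inj₂ (sym v≡x)
  ... | no v≢x  = inj₁ (punchOut-injective v≢x v≢u (trans (sym (mergeMap-≢ v≢x)) fx≡w))

  mergeMap-injective-off : ∀ {x} → x ≢ u → x ≢ v → ∀ {a} → mergeMap v≢u a ≡ mergeMap v≢u x → a ≡ x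
  mergeMap-injective-off {x} x≢u x≢v {a} fa≡fx with v ≟ a
  ... | yes refl with mergeMap-fibre-merged (trans (sym fa≡fx) mergeMap-v)
  ...   | inj₁ x≡u = contradiction x≡u x≢u
  ...   | inj₂ x≡v = contradiction x≡v x≢v
  mergeMap-injective-off {x} x≢u x≢v {a} fa≡fx | no v≢a =
    punchOut-injective v≢a (x≢v ∘ sym) (trans (sym (mergeMap-≢ v≢a)) (trans fa≡fx (mergeMap-≢ (x≢v ∘ sym))))

[≟]ᵇ≡1 : ∀ {n} {x y : Fin n} → x ≡ y → [ x ≟ y ]ᵇ ≡ 1
[≟]ᵇ≡1 {x = x} {y} x≡y with x ≟ y
... | yes _   = refl
... | no x≢y = contradiction x≡y x≢y

[≟]ᵇ≡0 : ∀ {n} {x y : Fin n} → x ≢ y → [ x ≟ y ]ᵇ ≡ 0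
[≟]ᵇ≡0 {x = x} {y} x≢y with x ≟ y
... | yes x≡y = contradiction x≡y x≢y
... | no _    = refl

∈-removeAt⁻ : ∀ {A : Set} (xs : List A) i {p} → p ∈ˡ removeAt xs i → p ∈ˡ xs
∈-removeAt⁻ (_ ∷ xs) zero    p∈         = there p∈
∈-removeAt⁻ (_ ∷ xs) (suc i) (here p≡x) = here p≡x
∈-removeAt⁻ (_ ∷ xs) (suc i) (there p∈) = there (∈-removeAt⁻ xs i p∈)

∈-removeAt⁺ : ∀ {A : Set} (xs : List A) i {p} → p ∈ˡ xs → p ≢ lookup xs i → p ∈ˡ removeAt xs i
∈-removeAt⁺ (_ ∷ xs) zero    (here p≡x) p≢x = contradiction p≡x p≢x
∈-removeAt⁺ (_ ∷ xs) zero    (there p∈) _   = p∈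
∈-removeAt⁺ (_ ∷ xs) (suc i) (here p≡x) _   = here p≡x
∈-removeAt⁺ (_ ∷ xs) (suc i) (there p∈) p≢  = there (∈-removeAt⁺ xs i p∈ p≢)

degree-removeAt : ∀ {n} (G : Graph n) i x →
                  degree G x ≡ [ proj₁ (lookup G i) ≟ x ]ᵇ + [ proj₂ (lookup G i) ≟ x ]ᵇ + degree (removeAt G i) x
degree-removeAt (_ ∷ G)       zero    x = refl
degree-removeAt ((a , b) ∷ G) (suc i) x rewrite degree-removeAt G i x =
  swap [ a ≟ x ]ᵇ [ b ≟ x ]ᵇ [ proj₁ (lookup G i) ≟ x ]ᵇ [ proj₂ (lookup G i) ≟ x ]ᵇ (degree (removeAt G i) x)
  where
  swap : ∀ a b c d r → a + b + (c + d + r) ≡ c + d + (a + b + r)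
  swap = solve-∀

Adjacent-removeAt⁻ : ∀ {n} (G : Graph n) i {x d} → Adjacent (removeAt G i) x d → Adjacent G x d
Adjacent-removeAt⁻ G i (inj₁ xd∈) = inj₁ (∈-removeAt⁻ G i xd∈)
Adjacent-removeAt⁻ G i (inj₂ dx∈) = inj₂ (∈-removeAt⁻ G i dx∈)

Adjacent-removeAt⁺ : ∀ {n} (G : Graph n) i {x d} → Adjacent G x d →
                     (x , d) ≢ lookup G i → (d , x) ≢ lookup G i → Adjacent (removeAt G i) x d
Adjacent-removeAt⁺ G i (inj₁ xd∈) xd≢e _   = inj₁ (∈-removeAt⁺ G i xd∈ xd≢e)
Adjacent-removeAt⁺ G i (inj₂ dx∈) _   dx≢e = inj₂ (∈-removeAt⁺ G i dx∈ dx≢e)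

mapEdges : ∀ {n m} → (Fin n → Fin m) → Graph n → Graph m
mapEdges f = map (λ (a , b) → f a , f b)

module _ {n m} (f : Fin n → Fin m) where

  Adjacent-mapEdges⁺ : ∀ (G : Graph n) {x d} → Adjacent G x d → Adjacent (mapEdges f G) (f x) (f d)
  Adjacent-mapEdges⁺ G (inj₁ xd∈) = inj₁ (∈-map⁺ _ xd∈)
  Adjacent-mapEdges⁺ G (inj₂ dx∈) = inj₂ (∈-map⁺ _ dx∈)

  Adjacent-mapEdges⁻ : ∀ (G : Graph n) {y d'} → Adjacent (mapEdges f G) y d' →
                       ∃[ x ] ∃[ d ] (f x ≡ y × f d ≡ d' × Adjacent G x d)
  Adjacent-mapEdges⁻ G (inj₁ yd'∈) with ∈-map⁻ _ yd'∈
  ... | (x , d) , xd∈ , refl = x , d , refl , refl , inj₁ xd∈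
  Adjacent-mapEdges⁻ G (inj₂ d'y∈) with ∈-map⁻ _ d'y∈
  ... | (d , x) , dx∈ , refl = x , d , refl , refl , inj₂ dx∈

  degree-mapEdges-injectiveAt : ∀ {x} → (∀ {a} → f a ≡ f x → a ≡ x) → ∀ G →
                                degree (mapEdges f G) (f x) ≡ degree G x
  degree-mapEdges-injectiveAt {x} fibre = go
    where
    indicator : ∀ a → [ f a ≟ f x ]ᵇ ≡ [ a ≟ x ]ᵇ
    indicator a with a ≟ x
    ... | yes refl = [≟]ᵇ≡1 refl
    ... | no a≢x   = [≟]ᵇ≡0 (a≢x ∘ fibre)
    go : ∀ G → degree (mapEdges f G) (f x) ≡ degree G x
    go []            = refl
    go ((a , b) ∷ G) rewrite indicator a | indicator b | go G = refl

  degree-mapEdges-merge : ∀ {x₁ x₂ y} → x₁ ≢ x₂ → f x₁ ≡ y → f x₂ ≡ y →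
                          (∀ {a} → f a ≡ y → a ≡ x₁ ⊎ a ≡ x₂) →
                          ∀ G → degree (mapEdges f G) y ≡ degree G x₁ + degree G x₂
  degree-mapEdges-merge {x₁} {x₂} {y} x₁≢x₂ fx₁≡y fx₂≡y fibre = go
    where
    indicator : ∀ a → [ f a ≟ y ]ᵇ ≡ [ a ≟ x₁ ]ᵇ + [ a ≟ x₂ ]ᵇ
    indicator a with a ≟ x₁ | a ≟ x₂
    ... | yes refl | yes a≡x₂ = contradiction a≡x₂ x₁≢x₂
    ... | yes refl | no _     = [≟]ᵇ≡1 fx₁≡y
    ... | no _     | yes refl = [≟]ᵇ≡1 fx₂≡y
    ... | no a≢x₁  | no a≢x₂  = [≟]ᵇ≡0 fa≢y
      where
      fa≢y : f a ≢ y
      fa≢y fa≡y with fibre fa≡y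
      ... | inj₁ a≡x₁ = a≢x₁ a≡x₁
      ... | inj₂ a≡x₂ = a≢x₂ a≡x₂
    regroup : ∀ a₁ a₂ b₁ b₂ r₁ r₂ →
              a₁ + a₂ + (b₁ + b₂) + (r₁ + r₂) ≡ a₁ + b₁ + r₁ + (a₂ + b₂ + r₂)
    regroup = solve-∀
    go : ∀ G → degree (mapEdges f G) y ≡ degree G x₁ + degree G x₂
    go []            = refl
    go ((a , b) ∷ G) rewrite indicator a | indicator b | go G =
      regroup [ a ≟ x₁ ]ᵇ [ a ≟ x₂ ]ᵇ [ b ≟ x₁ ]ᵇ [ b ≟ x₂ ]ᵇ (degree G x₁) (degree G x₂)

module Contraction {m} (G : Graph (suc m)) (e : Fin (length G))
                   (v≢u : proj₂ (lookup G e) ≢ proj₁ (lookup G e)) where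

  u v : Fin (suc m)
  u = proj₁ (lookup G e)
  v = proj₂ (lookup G e)

  f : Fin (suc m) → Fin m
  f = mergeMap v≢u

  w : Fin m
  w = punchOut v≢u

  G-e : Graph (suc m)
  G-e = removeAt G e

  -- Definitionally mapEdges f G-e, so the mapEdges lemmas apply to G/e.
  G/e : Graph m
  G/e = contract G e v≢u

  degree-u : degree G u ≡ suc (degree G-e u)
  degree-u = trans (degree-removeAt G e u) (cong₂ (λ a b → a + b + degree G-e u) ([≟]ᵇ≡1 refl) ([≟]ᵇ≡0 v≢u))

  degree-v : degree G v ≡ suc (degree G-e v)
  degree-v =
    trans (degree-removeAt G e v) (cong₂ (λ a b → a + b + degree G-e v) ([≟]ᵇ≡0 (v≢u ∘ sym)) ([≟]ᵇ≡1 refl))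

  degree-off-e : ∀ {x} → x ≢ u → x ≢ v → degree G x ≡ degree G-e x
  degree-off-e {x} x≢u x≢v =
    trans (degree-removeAt G e x)
          (cong₂ (λ a b → a + b + degree G-e x) ([≟]ᵇ≡0 (x≢u ∘ sym)) ([≟]ᵇ≡0 (x≢v ∘ sym)))

  degree-G/e-w : degree G/e w + 2 ≡ degree G u + degree G v
  degree-G/e-w = begin
    degree G/e w + 2                          ≡⟨ cong (_+ 2) (degree-mapEdges-merge f (v≢u ∘ sym)
                                                   (mergeMap-u v≢u) (mergeMap-v v≢u) (mergeMap-fibre-merged v≢u) G-e) ⟩
    degree G-e u + degree G-e v + 2           ≡⟨ regroup (degree G-e u) (degree G-e v) ⟩
    suc (degree G-e u) + suc (degree G-e v)   ≡⟨ sym (cong₂ _+_ degree-u degree-v) ⟩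
    degree G u + degree G v                   ∎
    where
    open ≡-Reasoning
    regroup : ∀ a b → a + b + 2 ≡ suc a + suc b
    regroup = solve-∀

  degree-G/e-off : ∀ {x} → x ≢ u → x ≢ v → degree G/e (f x) ≡ degree G x
  degree-G/e-off x≢u x≢v =
    trans (degree-mapEdges-injectiveAt f (mergeMap-injective-off v≢u x≢u x≢v) G-e) (sym (degree-off-e x≢u x≢v))

  even-degree-G/e-w : 2 ∣ degree G u → 2 ∣ degree G v → 2 ∣ degree G/e w
  even-degree-G/e-w 2∣u 2∣v = ∣m+n∣m⇒∣n 2∣2+w ∣-refl
    where
    2∣2+w : 2 ∣ 2 + degree G/e w
    2∣2+w = subst (2 ∣_) (trans (sym degree-G/e-w) (+-comm (degree G/e w) 2)) (∣m∣n⇒∣m+n 2∣u 2∣v)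

  Adjacent-G/e⁺ : ∀ {x d} → Adjacent G x d → (x , d) ≢ (u , v) → (d , x) ≢ (u , v) → Adjacent G/e (f x) (f d)
  Adjacent-G/e⁺ x~d xd≢e dx≢e = Adjacent-mapEdges⁺ f (removeAt G e) (Adjacent-removeAt⁺ G e x~d xd≢e dx≢e)

  Adjacent-G/e⁻ : ∀ {y d'} → Adjacent G/e y d' → ∃[ x ] ∃[ d ] (f x ≡ y × f d ≡ d' × Adjacent G x d)
  Adjacent-G/e⁻ y~d' with Adjacent-mapEdges⁻ f G-e y~d'
  ... | x , d , fx≡y , fd≡d' , x~d = x , d , fx≡y , fd≡d' , Adjacent-removeAt⁻ G e x~d

  image-isCoEvenDominating : ∀ {D} → IsCoEvenDominating G D → IsCoEvenDominating G/e (image f D)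
  image-isCoEvenDominating {D} (dominating , coEven) = dominating′ , coEven′
    where
    notInD : ∀ {y x} → y ∉ image f D → f x ≡ y → x ∉ D
    notInD y∉ refl x∈D = y∉ (∈-image⁺ f x∈D)

    -- If x—d were e = uv, then v = d ∈ D and y = f u = f v ∈ f(D).
    dominatedVia : ∀ {y} → y ∉ image f D → ∀ {x} → f x ≡ y → x ≢ v →
                   ∃[ d' ] (d' ∈ image f D × Adjacent G/e y d')
    dominatedVia y∉ {x} refl x≢v with dominating x (notInD y∉ refl)
    ... | d , d∈D , x~d = f d , ∈-image⁺ f d∈D , Adjacent-G/e⁺ x~d xd≢e (x≢v ∘ cong proj₂)
      where
      xd≢e : (x , d) ≢ (u , v)
      xd≢e refl = y∉ (subst (_∈ image f D) (trans (mergeMap-v v≢u) (sym (mergeMap-u v≢u))) (∈-image⁺ f d∈D))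

    dominating′ : IsDominating G/e (image f D)
    dominating′ y y∉ = dominatedVia y∉ (mergeMap-punchIn v≢u y) (punchInᵢ≢i v y)

    coEven′ : ∀ y → y ∉ image f D → 2 ∣ degree G/e y
    coEven′ y y∉ with y ≟ w
    ... | yes refl = even-degree-G/e-w (coEven u (notInD y∉ (mergeMap-u v≢u))) (coEven v (notInD y∉ (mergeMap-v v≢u)))
    ... | no y≢w   = subst (λ t → 2 ∣ degree G/e t) fx≡y 2∣fx
      where
      x = punchIn v y
      fx≡y : f x ≡ y
      fx≡y = mergeMap-punchIn v≢u y
      x≢u : x ≢ u
      x≢u x≡u = y≢w (trans (sym fx≡y) (trans (cong f x≡u) (mergeMap-u v≢u)))
      x≢v : x ≢ v
      x≢v = punchInᵢ≢i v y
      2∣fx : 2 ∣ degree G/e (f x)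
      2∣fx = subst (2 ∣_) (sym (degree-G/e-off x≢u x≢v)) (coEven x (notInD y∉ fx≡y))

  lift : Subset m → Subset (suc m)
  lift D' = preimage f (D' ∪ ⁅ w ⁆)

  ∣lift∣≤∣D'∣+2 : ∀ D' → ∣ lift D' ∣ ≤ ∣ D' ∣ + 2
  ∣lift∣≤∣D'∣+2 D' = begin
    ∣ lift D' ∣                 ≤⟨ ∣preimage∣≤1+∣q∣ f v (mergeMap-punchIn v≢u) (D' ∪ ⁅ w ⁆) ⟩
    suc ∣ D' ∪ ⁅ w ⁆ ∣          ≤⟨ s≤s (∣p∪q∣≤∣p∣+∣q∣ D' ⁅ w ⁆) ⟩
    suc (∣ D' ∣ + ∣ ⁅ w ⁆ ∣)    ≡⟨ cong (λ c → suc (∣ D' ∣ + c)) (∣⁅x⁆∣≡1 w) ⟩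
    suc (∣ D' ∣ + 1)            ≡⟨ sym (+-suc ∣ D' ∣ 1) ⟩
    ∣ D' ∣ + 2                  ∎
    where open ≤-Reasoning

  lift-isCoEvenDominating : ∀ {D'} → IsCoEvenDominating G/e D' → IsCoEvenDominating G (lift D')
  lift-isCoEvenDominating {D'} (dominating , coEven) = dominating′ , coEven′
    where
    ∈-lift : ∀ {x} → f x ∈ D' ⊎ f x ≡ w → x ∈ lift D'
    ∈-lift (inj₁ fx∈D') = ∈-preimage⁺ f (x∈p∪q⁺ (inj₁ fx∈D'))
    ∈-lift (inj₂ fx≡w)  =
      ∈-preimage⁺ f (x∈p∪q⁺ {p = D'} (inj₂ (subst (_∈ ⁅ w ⁆) (sym fx≡w) (x∈⁅x⁆ w))))

    x∉lift⇒x≢u : ∀ {x} → x ∉ lift D' → x ≢ u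
    x∉lift⇒x≢u x∉ refl = x∉ (∈-lift (inj₂ (mergeMap-u v≢u)))

    x∉lift⇒x≢v : ∀ {x} → x ∉ lift D' → x ≢ v
    x∉lift⇒x≢v x∉ refl = x∉ (∈-lift (inj₂ (mergeMap-v v≢u)))

    dominating′ : IsDominating G (lift D')
    dominating′ x x∉ with dominating (f x) (x∉ ∘ ∈-lift ∘ inj₁)
    ... | d' , d'∈D' , fx~d' with Adjacent-G/e⁻ fx~d'
    ...   | a , d , fa≡fx , refl , a~d = d , ∈-lift (inj₁ d'∈D') , subst (λ t → Adjacent G t d) a≡x a~d
      where
      a≡x : a ≡ x
      a≡x = mergeMap-injective-off v≢u (x∉lift⇒x≢u x∉) (x∉lift⇒x≢v x∉) fa≡fx

    coEven′ : ∀ x → x ∉ lift D' → 2 ∣ degree G x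
    coEven′ x x∉ =
      subst (2 ∣_) (degree-G/e-off (x∉lift⇒x≢u x∉) (x∉lift⇒x≢v x∉)) (coEven (f x) (x∉ ∘ ∈-lift ∘ inj₁))

theorem3p4 : ∀ {m} (G : Graph (suc m)) (loopless : Loopless G) (e : Fin (length G))
             (k k' : ℕ) → γcoe G k → γcoe (contract G e (λ eq → loopless e (sym eq))) k' →
             (k ≤ k' + 2) × (k' ≤ k)
theorem3p4 G loopless e k k' ((D , D-coEven , ∣D∣≡k) , k-minimal) ((D' , D'-coEven , ∣D'∣≡k') , k'-minimal) =
  lower , upper
  where
  open Contraction G e (λ eq → loopless e (sym eq))
  lower : k ≤ k' + 2
  lower = ≤-trans (k-minimal (lift D') (lift-isCoEvenDominating D'-coEven))
                  (subst (λ c → ∣ lift D' ∣ ≤ c + 2) ∣D'∣≡k' (∣lift∣≤∣D'∣+2 D'))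
  upper : k' ≤ k
  upper = ≤-trans (k'-minimal (image f D) (image-isCoEvenDominating D-coEven))
                  (subst (∣ image f D ∣ ≤_) ∣D∣≡k (∣image∣≤∣p∣ f D))
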